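{- Let $K_n$ be the complete graph of order $n\ge 3$ and let $f_0: V(G_1)\to V(G_2)$ be a constant function, where $G_1,G_2$ are disjoint copies of $K_n$. Then $Z(C(K_n,f_0))=2n-2$.
   Context: Zero forcing: color each vertex of a graph $H$ black or white, with $S$ the initial set of black vertices. The color-change rule turns a white vertex $u_2$ black if $u_2$ is the only white neighbor of some black vertex $u_1$. $S$ is a zero forcing set of $H$ if all vertices become black after finitely many applications of the rule. $Z(H)$ is the minimum size of a zero forcing set of $H$. Functigraph: given disjoint copies $G_1,G_2$ of $G$ and $f:V(G_1)\to V(G_2)$, $C(G,f)$ has vertex set $V(G_1)\cup V(G_2)$ and edge set $E(G_1)\cup E(G_2)\cup\{uv \mid v=f(u)\}$. -}

module Defs where

open import Data.Nat using (ℕ; _≤_)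
open import Data.Fin using (Fin; splitAt)
open import Data.Fin.Subset using (Subset; _∈_; ∣_∣)
open import Data.Sum using (_⊎_; inj₁; inj₂)
open import Data.Product using (∃; _×_)
open import Relation.Binary.PropositionalEquality using (_≡_; _≢_)

record Graph (m : ℕ) : Set₁ where
  field
    Adj : Fin m → Fin m → Set

open Graph public

complete : (n : ℕ) → Graph n
complete n = record { Adj = λ a b → a ≢ b }

-- Functigraph C(G,f): vertex set Fin (n + n); the first n vertices are G₁,
-- the last n vertices are G₂; edges E(G₁) ∪ E(G₂) ∪ { u v | v = f(u) }.
functigraphAdj : {n : ℕ} → Graph n → (Fin n → Fin n) →
                 Fin n ⊎ Fin n → Fin n ⊎ Fin n → Set
functigraphAdj G f (inj₁ a) (inj₁ b) = Adj G a b
functigraphAdj G f (inj₂ a) (inj₂ b) = Adj G a b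
functigraphAdj G f (inj₁ a) (inj₂ b) = b ≡ f a
functigraphAdj G f (inj₂ b) (inj₁ a) = b ≡ f a

functigraph : {n : ℕ} → Graph n → (Fin n → Fin n) → Graph (n Data.Nat.+ n)
functigraph {n} G f = record
  { Adj = λ x y → functigraphAdj G f (splitAt n x) (splitAt n y) }

-- Vertices that eventually become black starting from the black set S,
-- under repeated application of the colour-change rule: a white vertex v
-- becomes black if it is the only white neighbour of some black vertex u.
data Black {m : ℕ} (H : Graph m) (S : Subset m) : Fin m → Set where
  initial : ∀ {v} → v ∈ S → Black H S v
  force   : ∀ {u v} → Black H S u → Adj H u v →
            (∀ w → Adj H u w → w ≢ v → Black H S w) →
            Black H S v

IsZeroForcingSet : {m : ℕ} → Graph m → Subset m → Set
IsZeroForcingSet H S = ∀ v → Black H S v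

ZeroForcingNumberIs : {m : ℕ} → Graph m → ℕ → Set
ZeroForcingNumberIs {m} H k =
  (∃ λ (S : Subset m) → IsZeroForcingSet H S × ∣ S ∣ ≡ k) ×
  (∀ (S : Subset m) → IsZeroForcingSet H S → k ≤ ∣ S ∣)

-- A fort of a graph is a nonempty vertex set F such that every vertex outside F
-- with a neighbour in F has at least two neighbours in F; no vertex of a fort
-- disjoint from S is ever forced, so a zero forcing set meets every fort.
-- With f₀ constant with value c, any three vertices of C(Kₙ, f₀) contain a
-- fort: two vertices of G₁ (twins), two vertices of G₂ other than c (twins),
-- or a vertex a of G₁ together with c and one more vertex b of G₂.  Hence a
-- zero forcing set misses at most two vertices.  Conversely, blackening all
-- vertices except a ∈ G₁ and f₀(a) ∈ G₂, a vertex b ≠ f₀(a) of G₂ forces f₀(a),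
-- after which any other vertex of G₁ forces a.
module Submission where

open import Defs
open import Data.Nat using (ℕ; suc; _≤_; _<_; _+_; _∸_; _≤?_; s≤s; z≤n)
open import Data.Nat.Properties
  using (≤-trans; ≤-reflexive; ≤-antisym; ≰⇒>; <⇒≱; +-suc; +-comm; +-monoʳ-≤;
         m≤n+m; n≤1+n; m≤n+o⇒m∸n≤o; m+n∸m≡n)
open import Data.Fin using (Fin; zero; suc; splitAt; join; punchIn)
open import Data.Fin.Properties
  using (splitAt-join; join-splitAt; punchInᵢ≢i; ¬∀⟶∃¬)
  renaming (_≟_ to _≟ᶠ_)
open import Data.Fin.Subset using (Subset; inside; outside; ⊤; ⁅_⁆; _-_; ∣_∣; _∈_; _∉_)
import Data.Fin.Subset as Subset
open import Data.Fin.Subset.Properties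
  using (_∈?_; ∣p∣≤∣x∷p∣; ∣⁅x⁆∣≡1; ∣⊤∣≡n; x∈⁅x⁆; x∈p∪q⁺; p⊆q⇒∣p∣≤∣q∣; ∈⊤;
         x∈p∧x≢y⇒x∈p-y; x∈p⇒∣p-x∣<∣p∣)
open import Data.Vec.Base using ([]; _∷_)
open import Data.Sum using (_⊎_; inj₁; inj₂)
import Data.Sum as Sum
open import Data.Sum.Properties using (inj₁-injective; inj₂-injective)
open import Data.Product using (∃; ∃₂; _×_; _,_)
open import Function using (_∘_; id; _⇔_; mk⇔; Equivalence)
open import Level using (0ℓ)
open import Data.Empty using (⊥-elim)
open import Relation.Nullary using (¬_; yes; no; contradiction)
open import Relation.Unary using (Pred; ｛_｝; _∪_; _⊆_; Satisfiable)
open import Relation.Binary.PropositionalEquality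

private variable
  m n : ℕ

∣p∪q∣≤∣p∣+∣q∣ : (p q : Subset m) → ∣ p Subset.∪ q ∣ ≤ ∣ p ∣ + ∣ q ∣
∣p∪q∣≤∣p∣+∣q∣ []            []            = z≤n
∣p∪q∣≤∣p∣+∣q∣ (inside  ∷ p) (s ∷ q)       =
  s≤s (≤-trans (∣p∪q∣≤∣p∣+∣q∣ p q) (+-monoʳ-≤ ∣ p ∣ (∣p∣≤∣x∷p∣ s q)))
∣p∪q∣≤∣p∣+∣q∣ (outside ∷ p) (inside  ∷ q) =
  ≤-trans (s≤s (∣p∪q∣≤∣p∣+∣q∣ p q)) (≤-reflexive (sym (+-suc ∣ p ∣ ∣ q ∣)))
∣p∪q∣≤∣p∣+∣q∣ (outside ∷ p) (outside ∷ q) = ∣p∪q∣≤∣p∣+∣q∣ p q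

∣p∪⁅x⁆∣≤1+∣p∣ : (p : Subset m) (x : Fin m) → ∣ p Subset.∪ ⁅ x ⁆ ∣ ≤ suc ∣ p ∣
∣p∪⁅x⁆∣≤1+∣p∣ p x = ≤-trans (∣p∪q∣≤∣p∣+∣q∣ p ⁅ x ⁆)
  (≤-reflexive (trans (cong (∣ p ∣ +_) (∣⁅x⁆∣≡1 x)) (+-comm ∣ p ∣ 1)))

x∉p∪⁅y⁆⇒x∉p×x≢y : {p : Subset m} {x y : Fin m} → x ∉ p Subset.∪ ⁅ y ⁆ → x ∉ p × x ≢ y
x∉p∪⁅y⁆⇒x∉p×x≢y {y = y} x∉ =
  (λ x∈p → x∉ (x∈p∪q⁺ (inj₁ x∈p))) , λ { refl → x∉ (x∈p∪q⁺ (inj₂ (x∈⁅x⁆ y))) }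

∣p∣<m⇒∃∉p : {p : Subset m} → ∣ p ∣ < m → ∃ λ x → x ∉ p
∣p∣<m⇒∃∉p {m} {p} ∣p∣<m = ¬∀⟶∃¬ m (_∈ p) (_∈? p) λ all∈p →
  <⇒≱ ∣p∣<m (subst (_≤ ∣ p ∣) (∣⊤∣≡n m) (p⊆q⇒∣p∣≤∣q∣ {p = ⊤} (λ {x} _ → all∈p x)))

three-∉ : (p : Subset m) → 3 + ∣ p ∣ ≤ m →
          ∃₂ λ x y → ∃ λ z → x ≢ y × x ≢ z × y ≢ z × x ∉ p × y ∉ p × z ∉ p
three-∉ p 3+∣p∣≤m
  with x , x∉p ← ∣p∣<m⇒∃∉p (≤-trans (m≤n+m (suc ∣ p ∣) 2) 3+∣p∣≤m)
  with y , y∉p∪x ← ∣p∣<m⇒∃∉p (≤-trans (s≤s (∣p∪⁅x⁆∣≤1+∣p∣ p x))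
                                      (≤-trans (n≤1+n (2 + ∣ p ∣)) 3+∣p∣≤m))
  with z , z∉p∪x∪y ← ∣p∣<m⇒∃∉p (≤-trans (s≤s (≤-trans (∣p∪⁅x⁆∣≤1+∣p∣ (p Subset.∪ ⁅ x ⁆) y)
                                                       (s≤s (∣p∪⁅x⁆∣≤1+∣p∣ p x))))
                                        3+∣p∣≤m)
  with y∉p , y≢x ← x∉p∪⁅y⁆⇒x∉p×x≢y y∉p∪x
  with z∉p∪x , z≢y ← x∉p∪⁅y⁆⇒x∉p×x≢y z∉p∪x∪y
  with z∉p , z≢x ← x∉p∪⁅y⁆⇒x∉p×x≢y z∉p∪x
  = x , y , z , y≢x ∘ sym , z≢x ∘ sym , z≢y ∘ sym , x∉p , y∉p , z∉p

-- Forts of an adjacency relation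

module _ {V : Set} (E : V → V → Set) where

  IsFort : Pred V 0ℓ → Set
  IsFort F = ∀ {u v} → ¬ F u → E u v → F v → ∃ λ w → E u w × w ≢ v × F w

  FortWithin : Pred V 0ℓ → Set₁
  FortWithin X = ∃ λ (F : Pred V 0ℓ) → IsFort F × Satisfiable F × F ⊆ X

  Twins : V → V → Set
  Twins p q = ∀ {u} → u ≢ p → u ≢ q → E u p ⇔ E u q

  FortWithin-mono : {X Y : Pred V 0ℓ} → X ⊆ Y → FortWithin X → FortWithin Y
  FortWithin-mono X⊆Y (F , fort , nonempty , F⊆X) = F , fort , nonempty , X⊆Y ∘ F⊆X

  twins⇒fort : {p q : V} → p ≢ q → Twins p q → IsFort (｛ p ｝ ∪ ｛ q ｝)
  twins⇒fort {p} {q} p≢q twins {u} u∉F uv (inj₁ refl) =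
    q , Equivalence.to (twins (u∉F ∘ inj₁ ∘ sym) (u∉F ∘ inj₂ ∘ sym)) uv , p≢q ∘ sym , inj₂ refl
  twins⇒fort {p} {q} p≢q twins {u} u∉F uq (inj₂ refl) =
    p , Equivalence.from (twins (u∉F ∘ inj₁ ∘ sym) (u∉F ∘ inj₂ ∘ sym)) uq , p≢q , inj₁ refl

  twins⇒fortWithin : {p q : V} → p ≢ q → Twins p q → FortWithin (｛ p ｝ ∪ ｛ q ｝)
  twins⇒fortWithin p≢q twins = _ , twins⇒fort p≢q twins , (_ , inj₁ refl) , id

module _ (H : Graph m) where

  fort-never-forced : {F : Pred (Fin m) 0ℓ} {S : Subset m} → IsFort (Adj H) F →
                      (∀ {v} → F v → v ∉ S) → ∀ {v} → Black H S v → ¬ F v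
  fort-never-forced fort F∩S≡∅ (initial v∈S) Fv = F∩S≡∅ Fv v∈S
  fort-never-forced fort F∩S≡∅ (force black-u uv others) Fv
    with w , uw , w≢v , Fw ← fort (fort-never-forced fort F∩S≡∅ black-u) uv Fv
    = fort-never-forced fort F∩S≡∅ (others w uw w≢v) Fw

  forts-in-triples⇒m≤2+∣S∣ :
    (∀ {x y z} → x ≢ y → x ≢ z → y ≢ z → FortWithin (Adj H) (｛ x ｝ ∪ ｛ y ｝ ∪ ｛ z ｝)) →
    {S : Subset m} → IsZeroForcingSet H S → m ≤ 2 + ∣ S ∣
  forts-in-triples⇒m≤2+∣S∣ forts {S} zfs with m ≤? 2 + ∣ S ∣
  ... | yes m≤2+∣S∣ = m≤2+∣S∣
  ... | no  m≰2+∣S∣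
    with x , y , z , x≢y , x≢z , y≢z , x∉S , y∉S , z∉S ← three-∉ S (≰⇒> m≰2+∣S∣)
    with F , fort , (v , Fv) , F⊆xyz ← forts x≢y x≢z y≢z
    = contradiction Fv (fort-never-forced fort F∩S≡∅ (zfs v))
    where
    F∩S≡∅ : ∀ {w} → F w → w ∉ S
    F∩S≡∅ Fw with F⊆xyz Fw
    ... | inj₁ refl        = x∉S
    ... | inj₂ (inj₁ refl) = y∉S
    ... | inj₂ (inj₂ refl) = z∉S

splitAt-injective : ∀ n {x y : Fin (n + n)} → splitAt n x ≡ splitAt n y → x ≡ y
splitAt-injective n {x} {y} eq =
  trans (sym (join-splitAt n n x)) (trans (cong (join n n) eq) (join-splitAt n n y))

join-≢ : (s t : Fin n ⊎ Fin n) → s ≢ t → join n n s ≢ join n n t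
join-≢ {n} s t s≢t eq =
  s≢t (trans (sym (splitAt-join n n s)) (trans (cong (splitAt n) eq) (splitAt-join n n t)))

module _ (G : Graph n) (f : Fin n → Fin n) where

  join-Adj : (s t : Fin n ⊎ Fin n) →
             functigraphAdj G f s t → Adj (functigraph G f) (join n n s) (join n n t)
  join-Adj s t = subst₂ (functigraphAdj G f) (sym (splitAt-join n n s)) (sym (splitAt-join n n t))

  join-Adj⁻¹ : (s t : Fin n ⊎ Fin n) →
               Adj (functigraph G f) (join n n s) (join n n t) → functigraphAdj G f s t
  join-Adj⁻¹ s t = subst₂ (functigraphAdj G f) (splitAt-join n n s) (splitAt-join n n t)

  fort-splitAt : {F : Pred (Fin n ⊎ Fin n) 0ℓ} →
                 IsFort (functigraphAdj G f) F → IsFort (Adj (functigraph G f)) (F ∘ splitAt n)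
  fort-splitAt {F} fort {u} u∉F uv Fv with w , uw , w≢v , Fw ← fort u∉F uv Fv =
    join n n w ,
    subst (functigraphAdj G f (splitAt n u)) (sym (splitAt-join n n w)) uw ,
    (λ { refl → w≢v (sym (splitAt-join n n w)) }) ,
    subst F (sym (splitAt-join n n w)) Fw

  fortWithin-splitAt : {X : Pred (Fin n ⊎ Fin n) 0ℓ} →
                       FortWithin (functigraphAdj G f) X →
                       FortWithin (Adj (functigraph G f)) (X ∘ splitAt n)
  fortWithin-splitAt (F , fort , (w , Fw) , F⊆X) =
    F ∘ splitAt n , fort-splitAt fort , (join n n w , subst F (sym (splitAt-join n n w)) Fw) , F⊆X

-- Forts of C(Kₙ, f) for a constant f

module _ (f : Fin n → Fin n) where

  private
    C : Fin n ⊎ Fin n → Fin n ⊎ Fin n → Set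
    C = functigraphAdj (complete n) f

  twins₁ : {a a′ : Fin n} → f a ≡ f a′ → Twins C (inj₁ a) (inj₁ a′)
  twins₁ fa≡fa′ {inj₁ x} u≢a u≢a′ = mk⇔ (λ _ → u≢a′ ∘ cong inj₁) (λ _ → u≢a ∘ cong inj₁)
  twins₁ fa≡fa′ {inj₂ x} _   _    = mk⇔ (λ x≡fa → trans x≡fa fa≡fa′) (λ x≡fa′ → trans x≡fa′ (sym fa≡fa′))

  twins₂ : {b b′ : Fin n} → (∀ x → b ≢ f x) → (∀ x → b′ ≢ f x) → Twins C (inj₂ b) (inj₂ b′)
  twins₂ b∉f b′∉f {inj₁ x} _   _    = mk⇔ (⊥-elim ∘ b∉f x) (⊥-elim ∘ b′∉f x)
  twins₂ b∉f b′∉f {inj₂ x} u≢b u≢b′ = mk⇔ (λ _ → u≢b′ ∘ cong inj₂) (λ _ → u≢b ∘ cong inj₂)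

  module _ (f-constant : ∀ x y → f x ≡ f y) where

    ≢f⇒∉image : {a b : Fin n} → b ≢ f a → ∀ x → b ≢ f x
    ≢f⇒∉image b≢fa x b≡fx = b≢fa (trans b≡fx (f-constant x _))

    -- Every vertex outside is adjacent to exactly two of the three: a vertex of
    -- G₁ to inj₁ a and inj₂ (f a), a vertex of G₂ to inj₂ b and inj₂ (f a).
    mixed-fort : {a b : Fin n} → b ≢ f a →
                 IsFort C (｛ inj₁ a ｝ ∪ ｛ inj₂ b ｝ ∪ ｛ inj₂ (f a) ｝)
    mixed-fort {a} {b} b≢fa {inj₁ x} u∉F _ (inj₁ refl) =
      inj₂ (f a) , f-constant a x , (λ ()) , inj₂ (inj₂ refl)
    mixed-fort {a} {b} b≢fa {inj₁ x} u∉F b≡fx (inj₂ (inj₁ refl)) =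
      contradiction b≡fx (≢f⇒∉image b≢fa x)
    mixed-fort {a} {b} b≢fa {inj₁ x} u∉F _ (inj₂ (inj₂ refl)) =
      inj₁ a , (λ x≡a → u∉F (inj₁ (cong inj₁ (sym x≡a)))) , (λ ()) , inj₁ refl
    mixed-fort {a} {b} b≢fa {inj₂ x} u∉F x≡fa (inj₁ refl) =
      contradiction (inj₂ (inj₂ (cong inj₂ (sym x≡fa)))) u∉F
    mixed-fort {a} {b} b≢fa {inj₂ x} u∉F _ (inj₂ (inj₁ refl)) =
      inj₂ (f a) , (λ x≡fa → u∉F (inj₂ (inj₂ (cong inj₂ (sym x≡fa))))) ,
      (λ fa≡b → b≢fa (sym (inj₂-injective fa≡b))) , inj₂ (inj₂ refl)
    mixed-fort {a} {b} b≢fa {inj₂ x} u∉F _ (inj₂ (inj₂ refl)) =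
      inj₂ b , (λ x≡b → u∉F (inj₂ (inj₁ (cong inj₂ (sym x≡b))))) ,
      (λ b≡fa → b≢fa (inj₂-injective b≡fa)) , inj₂ (inj₁ refl)

    fortWithin-G₁G₁ : {a a′ : Fin n} → a ≢ a′ → FortWithin C (｛ inj₁ a ｝ ∪ ｛ inj₁ a′ ｝)
    fortWithin-G₁G₁ {a} {a′} a≢a′ =
      twins⇒fortWithin C (a≢a′ ∘ inj₁-injective) (twins₁ (f-constant a a′))

    fortWithin-G₂G₂ : {a b b′ : Fin n} → b ≢ b′ → b ≢ f a → b′ ≢ f a →
                       FortWithin C (｛ inj₂ b ｝ ∪ ｛ inj₂ b′ ｝)
    fortWithin-G₂G₂ b≢b′ b≢fa b′≢fa =
      twins⇒fortWithin C (b≢b′ ∘ inj₂-injective) (twins₂ (≢f⇒∉image b≢fa) (≢f⇒∉image b′≢fa))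

    fortWithin-G₁G₂G₂ : {a b b′ : Fin n} → b ≢ b′ → FortWithin C (｛ inj₁ a ｝ ∪ ｛ inj₂ b ｝ ∪ ｛ inj₂ b′ ｝)
    fortWithin-G₁G₂G₂ {a} {b} {b′} b≢b′ with b ≟ᶠ f a | b′ ≟ᶠ f a
    ... | yes refl | yes b′≡fa = contradiction (sym b′≡fa) b≢b′
    ... | yes refl | no  b′≢fa =
      FortWithin-mono C (Sum.map₂ Sum.swap) (_ , mixed-fort b′≢fa , (_ , inj₁ refl) , id)
    ... | no  b≢fa | yes refl  = _ , mixed-fort b≢fa , (_ , inj₁ refl) , id
    ... | no  b≢fa | no  b′≢fa = FortWithin-mono C inj₂ (fortWithin-G₂G₂ b≢b′ b≢fa b′≢fa)

    fortWithin-G₂G₂G₂ : {b b′ b″ : Fin n} → b ≢ b′ → b ≢ b″ → b′ ≢ b″ →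
                     FortWithin C (｛ inj₂ b ｝ ∪ ｛ inj₂ b′ ｝ ∪ ｛ inj₂ b″ ｝)
    fortWithin-G₂G₂G₂ {b} {b′} {b″} b≢b′ b≢b″ b′≢b″ with b ≟ᶠ f b | b′ ≟ᶠ f b
    ... | yes b≡fb | _ = FortWithin-mono C inj₂
      (fortWithin-G₂G₂ b′≢b″ (λ b′≡fb → b≢b′ (trans b≡fb (sym b′≡fb)))
                              (λ b″≡fb → b≢b″ (trans b≡fb (sym b″≡fb))))
    ... | no  b≢fb | yes b′≡fb = FortWithin-mono C Sum.[ inj₁ , inj₂ ∘ inj₂ ]
      (fortWithin-G₂G₂ b≢b″ b≢fb λ b″≡fb → b′≢b″ (trans b′≡fb (sym b″≡fb)))
    ... | no  b≢fb | no  b′≢fb = FortWithin-mono C (Sum.map₂ inj₁)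
      (fortWithin-G₂G₂ b≢b′ b≢fb b′≢fb)

    fortWithin-triple : {p q r : Fin n ⊎ Fin n} → p ≢ q → p ≢ r → q ≢ r →
                        FortWithin C (｛ p ｝ ∪ ｛ q ｝ ∪ ｛ r ｝)
    fortWithin-triple {inj₁ a} {inj₁ a′} {_} p≢q _ _ =
      FortWithin-mono C (Sum.map₂ inj₁) (fortWithin-G₁G₁ (p≢q ∘ cong inj₁))
    fortWithin-triple {inj₁ a} {inj₂ _} {inj₁ a′} _ p≢r _ =
      FortWithin-mono C (Sum.map₂ inj₂) (fortWithin-G₁G₁ (p≢r ∘ cong inj₁))
    fortWithin-triple {inj₂ _} {inj₁ a} {inj₁ a′} _ _ q≢r =
      FortWithin-mono C inj₂ (fortWithin-G₁G₁ (q≢r ∘ cong inj₁))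
    fortWithin-triple {inj₁ a} {inj₂ b} {inj₂ b′} _ _ q≢r =
      fortWithin-G₁G₂G₂ (q≢r ∘ cong inj₂)
    fortWithin-triple {inj₂ b} {inj₁ a} {inj₂ b′} _ p≢r _ =
      FortWithin-mono C (λ { (inj₁ ∈a) → inj₂ (inj₁ ∈a) ; (inj₂ (inj₁ ∈b)) → inj₁ ∈b
                           ; (inj₂ (inj₂ ∈b′)) → inj₂ (inj₂ ∈b′) })
        (fortWithin-G₁G₂G₂ {a} (p≢r ∘ cong inj₂))
    fortWithin-triple {inj₂ b} {inj₂ b′} {inj₁ a} p≢q _ _ =
      FortWithin-mono C (λ { (inj₁ ∈a) → inj₂ (inj₂ ∈a) ; (inj₂ (inj₁ ∈b)) → inj₁ ∈b
                           ; (inj₂ (inj₂ ∈b′)) → inj₂ (inj₁ ∈b′) })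
        (fortWithin-G₁G₂G₂ {a} (p≢q ∘ cong inj₂))
    fortWithin-triple {inj₂ b} {inj₂ b′} {inj₂ b″} p≢q p≢r q≢r =
      fortWithin-G₂G₂G₂ (p≢q ∘ cong inj₂) (p≢r ∘ cong inj₂) (q≢r ∘ cong inj₂)

    functigraph-forts-in-triples :
      ∀ {x y z} → x ≢ y → x ≢ z → y ≢ z →
      FortWithin (Adj (functigraph (complete n) f)) (｛ x ｝ ∪ ｛ y ｝ ∪ ｛ z ｝)
    functigraph-forts-in-triples x≢y x≢z y≢z =
      FortWithin-mono _ (Sum.map injective (Sum.map injective injective))
        (fortWithin-splitAt (complete n) f
          (fortWithin-triple (x≢y ∘ injective) (x≢z ∘ injective) (y≢z ∘ injective)))
      where injective = splitAt-injective n

-- Forcing all but two vertices of C(Kₙ, f), for n ≥ 2 and any f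

module AllButTwo {k : ℕ} (f : Fin (suc (suc k)) → Fin (suc (suc k))) where

  private
    N : ℕ
    N = suc (suc k)

    H : Graph (N + N)
    H = functigraph (complete N) f

    ⌜_⌝ : Fin N ⊎ Fin N → Fin (N + N)
    ⌜_⌝ = join N N

    ⌜⌝-Adj : (s t : Fin N ⊎ Fin N) → functigraphAdj (complete N) f s t → Adj H ⌜ s ⌝ ⌜ t ⌝
    ⌜⌝-Adj = join-Adj (complete N) f

    ⌜⌝-Adj⁻¹ : (s t : Fin N ⊎ Fin N) → Adj H ⌜ s ⌝ ⌜ t ⌝ → functigraphAdj (complete N) f s t
    ⌜⌝-Adj⁻¹ = join-Adj⁻¹ (complete N) f

  x y : Fin (N + N)
  x = ⌜ inj₁ zero ⌝
  y = ⌜ inj₂ (f zero) ⌝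

  S : Subset (N + N)
  S = ⊤ - x - y

  ∈S : ∀ {v} → v ≢ x → v ≢ y → v ∈ S
  ∈S v≢x v≢y = x∈p∧x≢y⇒x∈p-y (x∈p∧x≢y⇒x∈p-y ∈⊤ v≢x) v≢y

  y≢x : y ≢ x
  y≢x = join-≢ (inj₂ (f zero)) (inj₁ zero) (λ ())

  2+∣S∣≤N+N : 2 + ∣ S ∣ ≤ N + N
  2+∣S∣≤N+N = ≤-trans (s≤s (x∈p⇒∣p-x∣<∣p∣ (x∈p∧x≢y⇒x∈p-y ∈⊤ y≢x)))
                      (subst (suc ∣ ⊤ - x ∣ ≤_) (∣⊤∣≡n (N + N)) (x∈p⇒∣p-x∣<∣p∣ {x = x} {p = ⊤} ∈⊤))

  y-black : Black H S y
  y-black = force (initial (∈S (join-≢ (inj₂ b) (inj₁ zero) (λ ()))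
                                (join-≢ (inj₂ b) (inj₂ (f zero)) (b≢fa ∘ inj₂-injective))))
                  (⌜⌝-Adj (inj₂ b) (inj₂ (f zero)) b≢fa) others
    where
    b : Fin N
    b = punchIn (f zero) zero
    b≢fa : b ≢ f zero
    b≢fa = punchInᵢ≢i (f zero) zero
    others : ∀ w → Adj H ⌜ inj₂ b ⌝ w → w ≢ y → Black H S w
    others w bw w≢y with w ≟ᶠ x
    ... | yes refl = contradiction (⌜⌝-Adj⁻¹ (inj₂ b) (inj₁ zero) bw) b≢fa
    ... | no  w≢x  = initial (∈S w≢x w≢y)

  x-black : Black H S x
  x-black = force (initial (∈S (join-≢ (inj₁ (suc zero)) (inj₁ zero) (λ ()))
                                (join-≢ (inj₁ (suc zero)) (inj₂ (f zero)) (λ ()))))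
                  (⌜⌝-Adj (inj₁ (suc zero)) (inj₁ zero) (λ ())) others
    where
    others : ∀ w → Adj H ⌜ inj₁ (suc zero) ⌝ w → w ≢ x → Black H S w
    others w _ w≢x with w ≟ᶠ y
    ... | yes refl = y-black
    ... | no  w≢y  = initial (∈S w≢x w≢y)

  S-zfs : IsZeroForcingSet H S
  S-zfs v with v ≟ᶠ x | v ≟ᶠ y
  ... | yes refl | _        = x-black
  ... | no  _    | yes refl = y-black
  ... | no  v≢x  | no  v≢y  = initial (∈S v≢x v≢y)

proposition4p2 : (n : ℕ) → 3 ≤ n → (f₀ : Fin n → Fin n) →
                 (∀ x y → f₀ x ≡ f₀ y) →
                 ZeroForcingNumberIs (functigraph (complete n) f₀) ((n + n) ∸ 2)
proposition4p2 n@(suc (suc (suc _))) (s≤s (s≤s (s≤s _))) f₀ f₀-constant =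
  (S , S-zfs , ∣S∣≡n+n∸2) , λ S′ S′-zfs → m≤n+o⇒m∸n≤o (n + n) 2 (lower S′-zfs)
  where
  open AllButTwo f₀
  lower : ∀ {S′} → IsZeroForcingSet (functigraph (complete n) f₀) S′ → n + n ≤ 2 + ∣ S′ ∣
  lower = forts-in-triples⇒m≤2+∣S∣ _ (functigraph-forts-in-triples f₀ f₀-constant)
  ∣S∣≡n+n∸2 : ∣ S ∣ ≡ (n + n) ∸ 2
  ∣S∣≡n+n∸2 = begin
    ∣ S ∣             ≡⟨ m+n∸m≡n 2 ∣ S ∣ ⟨
    2 + ∣ S ∣ ∸ 2     ≡⟨ cong (_∸ 2) (≤-antisym 2+∣S∣≤N+N (lower S-zfs)) ⟩
    (n + n) ∸ 2       ∎
    where open ≡-Reasoning
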